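{- Let $\mathbf{a}=(a_1,\ldots,a_n)$ be an ascent sequence. Then $\mathbf{a}$ satisfies \[ a_k \in [0,a_{k-1}] \cup \{1+\mathsf{asc}(a_1,\ldots,a_{k-1})\}\quad\text{for all } k\in(1,n] \] if and only if it satisfies \[ a_k \in [0,a_{k-1}] \cup \{1+\max(a_1,\ldots,a_{k-1})\}\quad\text{for all } k\in(1,n]. \] In other words, $\mathsf{RAsc}_n$ is exactly the set of ascent sequences of length $n$ satisfying the second condition.
   Context: For a sequence $(a_1,\ldots,a_k)$ of integers, $\mathsf{asc}(a_1,\ldots,a_k)$ is the number of indices $i\in[1,k)$ with $a_i<a_{i+1}$. An ascent sequence of length $n$ is a sequence $(a_1,\ldots,a_n)$ of non-negative integers with $a_1=0$ and $a_i\le \mathsf{asc}(a_1,\ldots,a_{i-1})+1$ for all $1<i\le n$. For integers $a\le b$, $[a,b]=\{a,a+1,\ldots,b\}$. $\mathsf{RAsc}_n$ denotes the set of ascent sequences $(a_1,\ldots,a_n)$ such that $a_k \in [0,a_{k-1}] \cup \{1+\mathsf{asc}(a_1,\ldots,a_{k-1})\}$ for all $k>1$. -}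

module Defs where

open import Data.Nat using (ℕ; zero; suc; _+_; _≤_; _<_; _<ᵇ_; _⊔_)
open import Data.Bool using (if_then_else_)
open import Data.List using (List; []; _∷_; length; take)
open import Data.Product using (_×_)
open import Data.Sum using (_⊎_)
open import Relation.Binary.PropositionalEquality using (_≡_)

asc : List ℕ → ℕ
asc []           = 0
asc (x ∷ [])     = 0
asc (x ∷ y ∷ xs) = (if x <ᵇ y then 1 else 0) + asc (y ∷ xs)

-- max (a₁,…,a_k) (0 for the empty sequence; only used on nonempty prefixes)
maxL : List ℕ → ℕ
maxL []       = 0
maxL (x ∷ xs) = x ⊔ maxL xs

-- 0-indexed access with default 0 (only used at valid indices below)
at : List ℕ → ℕ → ℕ
at []       _       = 0
at (x ∷ xs) zero    = x
at (x ∷ xs) (suc i) = at xs i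

-- Ascent sequence: a₁ = 0 and a_i ≤ asc(a₁,…,a_{i-1}) + 1 for 1 < i ≤ n.
-- In 0-based index j = i - 1: for 1 ≤ j < length a, at a j ≤ asc (take j a) + 1.
-- (The empty sequence is the unique ascent sequence of length 0.)
data StartsWithZero : List ℕ → Set where
  nil  : StartsWithZero []
  cons : ∀ {xs} → StartsWithZero (0 ∷ xs)

IsAscent : List ℕ → Set
IsAscent a = StartsWithZero a ×
  (∀ j → 1 ≤ j → j < length a → at a j ≤ asc (take j a) + 1)

AscCond : List ℕ → Set
AscCond a = ∀ j → 1 ≤ j → j < length a →
  (at a j ≤ at a (j Data.Nat.∸ 1)) ⊎ (at a j ≡ 1 + asc (take j a))

MaxCond : List ℕ → Set
MaxCond a = ∀ j → 1 ≤ j → j < length a →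
  (at a j ≤ at a (j Data.Nat.∸ 1)) ⊎ (at a j ≡ 1 + maxL (take j a))

RAsc : ℕ → List ℕ → Set
RAsc n a = (length a ≡ n) × IsAscent a × AscCond a

module Submission where

-- Call a nonempty prefix balanced when its maximum equals its number of
-- ascents.  Under either condition every nonempty prefix of a sequence starting
-- with 0 is balanced: a weak descent a_k ≤ a_{k-1} ≤ max creates neither an
-- ascent nor a new maximum, while a jump a_k = 1 + asc = 1 + max creates both.
-- On balanced prefixes 1 + asc and 1 + max coincide, so the two conditions
-- allow exactly the same values of a_k.

open import Defs
open import Data.Bool using (true; false; T; if_then_else_)
open import Data.Empty using (⊥-elim)
open import Data.List using (List; []; _∷_; length; take)
open import Data.Nat using (ℕ; zero; suc; _+_; _∸_; _≤_; _<_; _<ᵇ_; _⊔_; s≤s; z≤n)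
open import Data.Nat.Properties
open import Data.Product using (_×_; _,_; proj₁)
open import Data.Sum using (_⊎_; inj₁; inj₂; map₂)
open import Function.Bundles using (_⇔_; mk⇔; Equivalence)
open import Relation.Binary.PropositionalEquality

ascentBit : ℕ → ℕ → ℕ
ascentBit x y = if x <ᵇ y then 1 else 0

ascentBit-≥ : ∀ {x y} → y ≤ x → ascentBit x y ≡ 0
ascentBit-≥ {x} {y} y≤x with x <ᵇ y in eq
... | false = refl
... | true  = ⊥-elim (<⇒≱ (<ᵇ⇒< x y (subst T (sym eq) _)) y≤x)

ascentBit-< : ∀ {x y} → x < y → ascentBit x y ≡ 1
ascentBit-< {x} {y} x<y with x <ᵇ y in eq
... | true  = refl
... | false = ⊥-elim (subst T eq (<⇒<ᵇ x<y))

asc-take-suc : ∀ (a : List ℕ) i → suc i < length a →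
  asc (take (suc (suc i)) a) ≡ asc (take (suc i) a) + ascentBit (at a i) (at a (suc i))
asc-take-suc (_ ∷ [])    zero (s≤s ())
asc-take-suc (x ∷ y ∷ _) zero _ = +-comm (ascentBit x y) 0
asc-take-suc (x ∷ y ∷ a) (suc i) (s≤s i<len) = begin
  ascentBit x y + asc (take (suc (suc i)) (y ∷ a))
    ≡⟨ cong (ascentBit x y +_) (asc-take-suc (y ∷ a) i i<len) ⟩
  ascentBit x y + (asc (take (suc i) (y ∷ a)) + _)
    ≡⟨ +-assoc (ascentBit x y) _ _ ⟨
  ascentBit x y + asc (take (suc i) (y ∷ a)) + _ ∎
  where open ≡-Reasoning

maxL-take-suc : ∀ (a : List ℕ) i → i < length a →
  maxL (take (suc i) a) ≡ maxL (take i a) ⊔ at a i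
maxL-take-suc (x ∷ _) zero    _            = ⊔-comm x 0
maxL-take-suc (x ∷ a) (suc i) (s≤s i<len) =
  trans (cong (x ⊔_) (maxL-take-suc a i i<len)) (sym (⊔-assoc x _ _))

at≤maxL-take-suc : ∀ (a : List ℕ) i → i < length a → at a i ≤ maxL (take (suc i) a)
at≤maxL-take-suc a i i<len =
  subst (at a i ≤_) (sym (maxL-take-suc a i i<len)) (m≤n⊔m _ _)

Balanced : List ℕ → Set
Balanced ℓ = maxL ℓ ≡ asc ℓ

-- AscCond is Cond asc and MaxCond is Cond maxL, definitionally.
Cond : (List ℕ → ℕ) → List ℕ → Set
Cond X a = ∀ j → 1 ≤ j → j < length a →
  (at a j ≤ at a (j ∸ 1)) ⊎ (at a j ≡ 1 + X (take j a))

MaxOnBalanced : (List ℕ → ℕ) → Set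
MaxOnBalanced X = ∀ ℓ → Balanced ℓ → X ℓ ≡ maxL ℓ

asc-maxOnBalanced : MaxOnBalanced asc
asc-maxOnBalanced _ balanced = sym balanced

maxL-maxOnBalanced : MaxOnBalanced maxL
maxL-maxOnBalanced _ _ = refl

-- m, s: maximum and ascent count of the prefix; p: its last entry; q: the next one.
balanced-step : ∀ {m s p q} → p ≤ m → m ≡ s → q ≤ p ⊎ q ≡ suc m →
  m ⊔ q ≡ s + ascentBit p q
balanced-step {m} {s} {p} {q} p≤m m≡s (inj₁ q≤p) = begin
  m ⊔ q                     ≡⟨ m≥n⇒m⊔n≡m (≤-trans q≤p p≤m) ⟩
  m                         ≡⟨ m≡s ⟩
  s                         ≡⟨ +-identityʳ s ⟨
  s + 0                     ≡⟨ cong (s +_) (ascentBit-≥ {p} q≤p) ⟨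
  s + ascentBit p q         ∎
  where open ≡-Reasoning
balanced-step {m} {s} {p} p≤m m≡s (inj₂ refl) = begin
  m ⊔ suc m                 ≡⟨ m≤n⇒m⊔n≡n (n≤1+n m) ⟩
  suc m                     ≡⟨ cong suc m≡s ⟩
  suc s                     ≡⟨ +-comm 1 s ⟩
  s + 1                     ≡⟨ cong (s +_) (ascentBit-< {p} (s≤s p≤m)) ⟨
  s + ascentBit p (suc m)   ∎
  where open ≡-Reasoning

prefixes-balanced : ∀ {X} → MaxOnBalanced X → (a : List ℕ) → StartsWithZero a → Cond X a →
  ∀ i → i < length a → Balanced (take (suc i) a)
prefixes-balanced _ (0 ∷ _) cons _ zero _ = refl
prefixes-balanced maxOnBalanced a startsWithZero cond (suc i) i+1<len
  rewrite maxL-take-suc a (suc i) i+1<len | asc-take-suc a i i+1<len =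
  balanced-step (at≤maxL-take-suc a i i<len) balanced
    (map₂ (λ eq → trans eq (cong suc (maxOnBalanced _ balanced))) (cond (suc i) (s≤s z≤n) i+1<len))
  where
  i<len : i < length a
  i<len = <⇒≤ i+1<len
  balanced : Balanced (take (suc i) a)
  balanced = prefixes-balanced maxOnBalanced a startsWithZero cond i i<len

Cond-transfer : ∀ {X Y} → MaxOnBalanced X → MaxOnBalanced Y →
  (a : List ℕ) → StartsWithZero a → Cond X a → Cond Y a
Cond-transfer {X} {Y} maxOnX maxOnY a startsWithZero cond j@(suc i) 1≤j j<len =
  map₂ (λ eq → trans eq (cong suc X≡Y)) (cond j 1≤j j<len)
  where
  balanced : Balanced (take j a)
  balanced = prefixes-balanced maxOnX a startsWithZero cond i (<⇒≤ j<len)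
  X≡Y : X (take j a) ≡ Y (take j a)
  X≡Y = trans (maxOnX _ balanced) (sym (maxOnY _ balanced))

AscCond⇔MaxCond : (a : List ℕ) → StartsWithZero a → AscCond a ⇔ MaxCond a
AscCond⇔MaxCond a startsWithZero = mk⇔
  (Cond-transfer asc-maxOnBalanced maxL-maxOnBalanced a startsWithZero)
  (Cond-transfer maxL-maxOnBalanced asc-maxOnBalanced a startsWithZero)

lemma3p2 : (n : ℕ) →
    ((a : List ℕ) → length a ≡ n → IsAscent a → (AscCond a ⇔ MaxCond a)) ×
    ((a : List ℕ) → (RAsc n a ⇔ (length a ≡ n × IsAscent a × MaxCond a)))
lemma3p2 n =
  (λ a _ ascent → AscCond⇔MaxCond a (proj₁ ascent)) ,
  (λ a → mk⇔
    (λ { (len , ascent , cond) → len , ascent , to (AscCond⇔MaxCond a (proj₁ ascent)) cond })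
    (λ { (len , ascent , cond) → len , ascent , from (AscCond⇔MaxCond a (proj₁ ascent)) cond }))
  where open Equivalence
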